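{- For an integer $n\ge 2$, let $S_n=\{(a,b)\in\mathbb{Z}^2: 2^n-2^{n-2}\le a,b<2^n\}$ and let $x_n$ be the number of pairs $(a,b)\in S_n$ satisfying $|a-b|\le 2^{\max\{v_2(a),v_2(b)\}}$. Then for every integer $n\ge 3$, $$x_n\ge 2x_{n-1}+2^{n-1}-2.$$
   Context: $v_2(a)$ denotes the largest $j$ such that $2^j$ divides the positive integer $a$. -}

module Defs where

open import Data.Nat using (ℕ; zero; suc; _+_; _*_; _∸_; _^_; _≤_; _≤?_; _⊔_)
open import Data.Nat.DivMod using (_/_; _%_)
open import Data.Nat.Properties using (_≟_)
open import Data.List using (List; []; _∷_; length; filter; upTo; map; concatMap; cartesianProduct)
open import Data.Product using (_×_; _,_)
open import Relation.Nullary using (Dec; yes; no)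

-- Computed by repeatedly halving while even; fuel a is always enough for a > 0
-- (v₂(a) ≤ a).  For a = 0 it returns 0 (never used below: all arguments are ≥ 3).
v2-fuel : ℕ → ℕ → ℕ
v2-fuel zero    a = 0
v2-fuel (suc f) zero = 0
v2-fuel (suc f) (suc a) with (suc a) % 2 ≟ 0
... | yes _ = suc (v2-fuel f ((suc a) / 2))
... | no  _ = 0

v2 : ℕ → ℕ
v2 a = v2-fuel a a

dist : ℕ → ℕ → ℕ
dist a b = (a ∸ b) + (b ∸ a)

range : ℕ → ℕ → List ℕ
range lo hi = map (lo +_) (upTo (hi ∸ lo))

S : ℕ → List (ℕ × ℕ)
S n = cartesianProduct (range (2 ^ n ∸ 2 ^ (n ∸ 2)) (2 ^ n)) (range (2 ^ n ∸ 2 ^ (n ∸ 2)) (2 ^ n))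

good? : (p : ℕ × ℕ) → Dec (dist (Data.Product.proj₁ p) (Data.Product.proj₂ p)
                             ≤ 2 ^ (v2 (Data.Product.proj₁ p) ⊔ v2 (Data.Product.proj₂ p)))
good? (a , b) = dist a b ≤? 2 ^ (v2 a ⊔ v2 b)

x : ℕ → ℕ
x n = length (filter good? (S n))

-- Every (a, b) ∈ S (n - 1) spawns the 2 × 2 block {2a, 2a+1} × {2b, 2b+1} of S n.  Writing
-- ρ a = 2 ^ v₂ a, call b near a when a - ρ a ≤ b < a + ρ a.  Inside a block, (2a, 2b) is good
-- whenever (a, b) is, the odd diagonal entry (2a+1, 2a+1) is good, and (2a, 2b+1) resp.
-- (2a+1, 2b) is good as soon as b is near a resp. a is near b.  Since ρ (a + ρ a) > ρ a, one
-- of a, b is near the other whenever (a, b) is good, so each good pair yields two good pairs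
-- in its block and a mutually near pair yields three.  Hence
--   x n ≥ 2 x (n - 1) + #(diagonal of S (n - 1)) + #(mutually near pairs in S (n - 1)).
-- The diagonal has 2 ^ (n - 3) entries, and the mutually near pairs obey the same block
-- recursion with three new ones per diagonal entry, so there are at least 3 · 2 ^ (n - 3) - 2,
-- and 2 ^ (n - 3) + 3 · 2 ^ (n - 3) - 2 = 2 ^ (n - 1) - 2.
module Submission where

open import Defs
open import Data.Nat using (ℕ; _+_; _*_; _∸_; _^_; _≤_)
open import Data.Nat using (zero; suc; _<_; _⊔_; z≤n; s≤s; _≤?_; NonZero; >-nonZero)
open import Data.Nat.Properties
open import Algebra.Properties.CommutativeSemigroup +-commutativeSemigroup
  using () renaming (interchange to +-interchange)
open import Data.Nat.DivMod using (_/_; _%_; m*n%n≡0; m*n/n≡m; [m+kn]%n≡m%n; m/n<m)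
open import Data.Nat.Induction using (<-wellFounded)
open import Data.Nat.ListAction using (sum)
open import Data.Nat.ListAction.Properties using (sum-++)
open import Data.Nat.Tactic.RingSolver using (solve-∀)
open import Data.List using (List; []; _∷_; _++_; length; filter; map; applyUpTo; cartesianProduct)
open import Data.List.Properties using (map-++; map-∘)
open import Data.Product using (_×_; _,_)
open import Data.Sum using (_⊎_; inj₁; inj₂; [_,_])
open import Function using (_∘_; id)
open import Induction.WellFounded using (Acc; acc)
open import Relation.Nullary using (Dec; yes; no; contradiction)
open import Relation.Nullary.Decidable using (_×-dec_)
open import Relation.Binary.PropositionalEquality
  using (_≡_; refl; sym; trans; cong; cong₂; subst; subst₂; module ≡-Reasoning)

-- Parity and the 2-adic valuation

data Parity : ℕ → Set where
  even : ∀ c → Parity (2 * c)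
  odd  : ∀ c → Parity (1 + 2 * c)

parity : ∀ n → Parity n
parity zero = even 0
parity (suc n) with parity n
... | even c = odd c
... | odd c  = subst Parity (cong suc (+-suc c (c + 0))) (even (suc c))

2*c%2≡0 : ∀ c → 2 * c % 2 ≡ 0
2*c%2≡0 c = trans (cong (_% 2) (*-comm 2 c)) (m*n%n≡0 c 2)

[1+2*c]%2≡1 : ∀ c → (1 + 2 * c) % 2 ≡ 1
[1+2*c]%2≡1 c = trans (cong (λ m → (1 + m) % 2) (*-comm 2 c)) ([m+kn]%n≡m%n 1 c 2)

2*c/2≡c : ∀ c → 2 * c / 2 ≡ c
2*c/2≡c c = trans (cong (_/ 2) (*-comm 2 c)) (m*n/n≡m c 2)

v2-fuel-zero : ∀ f → v2-fuel f 0 ≡ 0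
v2-fuel-zero zero    = refl
v2-fuel-zero (suc f) = refl

v2-fuel-irrelevant : ∀ f f′ a → a ≤ f → a ≤ f′ → v2-fuel f a ≡ v2-fuel f′ a
v2-fuel-irrelevant f f′ zero _ _ = trans (v2-fuel-zero f) (sym (v2-fuel-zero f′))
v2-fuel-irrelevant (suc f) (suc f′) (suc a) (s≤s a≤f) (s≤s a≤f′) with suc a % 2 ≟ 0
... | yes _ =
  cong suc (v2-fuel-irrelevant f f′ (suc a / 2) (≤-trans half≤a a≤f) (≤-trans half≤a a≤f′))
  where
  half≤a : suc a / 2 ≤ a
  half≤a = ≤-pred (m/n<m (suc a) 2 (s≤s (s≤s z≤n)))
... | no _  = refl

v2-fuel-even : ∀ f a → suc a % 2 ≡ 0 → v2-fuel (suc f) (suc a) ≡ suc (v2-fuel f (suc a / 2))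
v2-fuel-even f a a%2≡0 with suc a % 2 ≟ 0
... | yes _     = refl
... | no a%2≢0  = contradiction a%2≡0 a%2≢0

v2-fuel-odd : ∀ f a → suc a % 2 ≡ 1 → v2-fuel (suc f) (suc a) ≡ 0
v2-fuel-odd f a a%2≡1 with suc a % 2 ≟ 0
... | yes a%2≡0 = contradiction (trans (sym a%2≡1) a%2≡0) λ ()
... | no _      = refl

v2-double : ∀ c → .{{NonZero c}} → v2 (2 * c) ≡ suc (v2 c)
v2-double c@(suc c′) = begin
  v2 (2 * c)                   ≡⟨ v2-fuel-even m m (2*c%2≡0 c) ⟩
  suc (v2-fuel m (2 * c / 2))  ≡⟨ cong (suc ∘ v2-fuel m) (2*c/2≡c c) ⟩
  suc (v2-fuel m c)            ≡⟨ cong suc (v2-fuel-irrelevant m c c c≤m ≤-refl) ⟩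
  suc (v2 c)                   ∎
  where
  open ≡-Reasoning
  m = c′ + (c + 0)
  c≤m : c ≤ m
  c≤m = ≤-trans (m≤m+n c 0) (m≤n+m (c + 0) c′)

v2-odd : ∀ c → v2 (1 + 2 * c) ≡ 0
v2-odd c = v2-fuel-odd (2 * c) (2 * c) ([1+2*c]%2≡1 c)

ρ : ℕ → ℕ
ρ a = 2 ^ v2 a

ρ>0 : ∀ a → 0 < ρ a
ρ>0 a = m^n>0 2 (v2 a)

ρ-double : ∀ c → .{{NonZero c}} → ρ (2 * c) ≡ 2 * ρ c
ρ-double c = cong (2 ^_) (v2-double c)

ρ-odd : ∀ c → ρ (1 + 2 * c) ≡ 1
ρ-odd c = cong (2 ^_) (v2-odd c)

ρ-jump : ∀ b → .{{NonZero b}} → 2 * ρ b ≤ ρ (b + ρ b)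
ρ-jump b = jump b (<-wellFounded b)
  where
  open ≤-Reasoning
  jump : ∀ b → Acc _<_ b → .{{NonZero b}} → 2 * ρ b ≤ ρ (b + ρ b)
  jump b _ with parity b
  ... | odd c = begin
    2 * ρ (1 + 2 * c)          ≡⟨ cong (2 *_) (ρ-odd c) ⟩
    2 * 1                      ≤⟨ *-monoʳ-≤ 2 (ρ>0 (suc c)) ⟩
    2 * ρ (suc c)              ≡⟨ ρ-double (suc c) ⟨
    ρ (2 * suc c)              ≡⟨ cong ρ (trans (*-distribˡ-+ 2 1 c) (+-comm 1 (1 + 2 * c))) ⟩
    ρ (1 + 2 * c + 1)          ≡⟨ cong (λ r → ρ (1 + 2 * c + r)) (ρ-odd c) ⟨
    ρ (1 + 2 * c + ρ (1 + 2 * c)) ∎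
  jump _ (acc rec) | even c@(suc _) = begin
    2 * ρ (2 * c)              ≡⟨ cong (2 *_) (ρ-double c) ⟩
    2 * (2 * ρ c)              ≤⟨ *-monoʳ-≤ 2 (jump c (rec (m<m+n c (s≤s z≤n)))) ⟩
    2 * ρ (c + ρ c)            ≡⟨ ρ-double (c + ρ c) ⟨
    ρ (2 * (c + ρ c))          ≡⟨ cong ρ (*-distribˡ-+ 2 c (ρ c)) ⟩
    ρ (2 * c + 2 * ρ c)        ≡⟨ cong (λ r → ρ (2 * c + r)) (ρ-double c) ⟨
    ρ (2 * c + ρ (2 * c))      ∎

-- Good and near pairs

Within : ℕ → ℕ → ℕ → Set
Within z a b = a ≤ b + z × b ≤ a + z

within-sym : ∀ {z a b} → Within z a b → Within z b a
within-sym (p , q) = q , p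

within-mono : ∀ {z z′ a b} → z ≤ z′ → Within z a b → Within z′ a b
within-mono {a = a} {b} z≤z′ (p , q) = ≤-trans p (+-monoʳ-≤ b z≤z′) , ≤-trans q (+-monoʳ-≤ a z≤z′)

2*-mono-≤ : ∀ {x} y z → x ≤ y + z → 2 * x ≤ 2 * y + 2 * z
2*-mono-≤ y z p = ≤-trans (*-monoʳ-≤ 2 p) (≤-reflexive (*-distribˡ-+ 2 y z))

2*-mono-< : ∀ {x} y z → x < y + z → 2 * x < 2 * y + 2 * z
2*-mono-< y z p = <-≤-trans (*-monoʳ-< 2 p) (≤-reflexive (*-distribˡ-+ 2 y z))

within-double : ∀ {z a b} → Within z a b → Within (2 * z) (2 * a) (2 * b)
within-double {z} {a} {b} (p , q) = 2*-mono-≤ b z p , 2*-mono-≤ a z q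

dist≤⇒within : ∀ {z a b} → dist a b ≤ z → Within z a b
dist≤⇒within {z} {a} {b} d =
  ≤-trans (m≤n+m∸n a b) (+-monoʳ-≤ b (≤-trans (m≤m+n (a ∸ b) (b ∸ a)) d)) ,
  ≤-trans (m≤n+m∸n b a) (+-monoʳ-≤ a (≤-trans (m≤n+m (b ∸ a) (a ∸ b)) d))

within⇒dist≤ : ∀ {z a b} → Within z a b → dist a b ≤ z
within⇒dist≤ {z} {a} {b} (p , q) with ≤-total a b
... | inj₁ a≤b rewrite m≤n⇒m∸n≡0 a≤b = m≤n+o⇒m∸n≤o b a q
... | inj₂ b≤a rewrite m≤n⇒m∸n≡0 b≤a | +-identityʳ (a ∸ b) = m≤n+o⇒m∸n≤o a b p

Good : ℕ → ℕ → Set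
Good a b = dist a b ≤ 2 ^ (v2 a ⊔ v2 b)

2^[v2⊔v2]≡ρ⊔ρ : ∀ a b → 2 ^ (v2 a ⊔ v2 b) ≡ ρ a ⊔ ρ b
2^[v2⊔v2]≡ρ⊔ρ a b = mono-≤-distrib-⊔ (^-monoʳ-≤ 2) (v2 a) (v2 b)

good⇒within : ∀ {a b} → Good a b → Within (ρ a ⊔ ρ b) a b
good⇒within {a} {b} g = dist≤⇒within (subst (dist a b ≤_) (2^[v2⊔v2]≡ρ⊔ρ a b) g)

within⇒good : ∀ {a b} → Within (ρ a ⊔ ρ b) a b → Good a b
within⇒good {a} {b} w = subst (dist a b ≤_) (sym (2^[v2⊔v2]≡ρ⊔ρ a b)) (within⇒dist≤ w)

good-refl : ∀ a → Good a a
good-refl a rewrite n∸n≡0 a = z≤n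

good-sym : ∀ a b → Good a b → Good b a
good-sym a b = subst₂ _≤_ (+-comm (a ∸ b) (b ∸ a)) (cong (2 ^_) (⊔-comm (v2 a) (v2 b)))

good-double : ∀ {a b} → .{{NonZero a}} → .{{NonZero b}} → Good a b → Good (2 * a) (2 * b)
good-double {a} {b} g =
  within⇒good (subst (λ z → Within z (2 * a) (2 * b)) ρ⊔ρ-double (within-double (good⇒within {a} {b} g)))
  where
  ρ⊔ρ-double : 2 * (ρ a ⊔ ρ b) ≡ ρ (2 * a) ⊔ ρ (2 * b)
  ρ⊔ρ-double = trans (*-distribˡ-⊔ 2 (ρ a) (ρ b)) (sym (cong₂ _⊔_ (ρ-double a) (ρ-double b)))

-- For a > 0, Near a b says exactly that (2a, 2b + 1) is good: |2a - (2b + 1)| ≤ 2 ρ a = ρ (2a).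
Near : ℕ → ℕ → Set
Near a b = a ≤ b + ρ a × b < a + ρ a

near? : ∀ a b → Dec (Near a b)
near? a b = (a ≤? b + ρ a) ×-dec (suc b ≤? a + ρ a)

near-refl : ∀ a → Near a a
near-refl a = m≤m+n a (ρ a) , m<m+n a (ρ>0 a)

near-double : ∀ {a b} → .{{NonZero a}} → Near a b → Near (2 * a) (2 * b)
near-double {a} {b} {{a≢0}} (p , q) rewrite ρ-double a {{a≢0}} =
  2*-mono-≤ b (ρ a) p , 2*-mono-< a (ρ a) q

near-even-succ : ∀ a → .{{NonZero a}} → Near (2 * a) (1 + 2 * a)
near-even-succ a {{a≢0}} rewrite ρ-double a {{a≢0}} =
  m≤n⇒m≤1+n (m≤m+n (2 * a) (2 * ρ a)) ,
  ≤-trans (≤-reflexive (+-comm 2 (2 * a))) (+-monoʳ-≤ (2 * a) (*-monoʳ-≤ 2 (ρ>0 a)))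

near-odd-pred : ∀ a → Near (1 + 2 * a) (2 * a)
near-odd-pred a rewrite ρ-odd a = ≤-reflexive (+-comm 1 (2 * a)) , s≤s (m≤m+n (2 * a) 1)

near⇒good : ∀ {a b} → .{{NonZero a}} → Near a b → Good (2 * a) (1 + 2 * b)
near⇒good {a} {b} (p , q) =
  within⇒good (within-mono ρ₂ₐ≤ (m≤n⇒m≤1+n (2*-mono-≤ b (ρ a) p) , 2*-mono-< a (ρ a) q))
  where
  ρ₂ₐ≤ : 2 * ρ a ≤ ρ (2 * a) ⊔ ρ (1 + 2 * b)
  ρ₂ₐ≤ = ≤-trans (≤-reflexive (sym (ρ-double a))) (m≤m⊔n _ _)

-- The boundary case a = b + ρ b is excluded by ρ-jump.
within⇒near : ∀ {a b} → .{{NonZero b}} → ρ a ≤ ρ b → Within (ρ b) a b → Near b a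
within⇒near {a} {b} ρa≤ρb (a≤b+ρb , b≤a+ρb) with m≤n⇒m<n∨m≡n a≤b+ρb
... | inj₁ a<b+ρb = b≤a+ρb , a<b+ρb
... | inj₂ refl   = contradiction (≤-trans (ρ-jump b) ρa≤ρb) (<⇒≱ ρb<2ρb)
  where
  ρb<2ρb : ρ b < 2 * ρ b
  ρb<2ρb = m<m+n (ρ b) (≤-trans (ρ>0 b) (m≤m+n (ρ b) 0))

good⇒near⊎near : ∀ {a b} → .{{NonZero a}} → .{{NonZero b}} → Good a b → Near a b ⊎ Near b a
good⇒near⊎near {a} {b} g with good⇒within {a} {b} g | ≤-total (ρ a) (ρ b)
... | w | inj₁ ρa≤ρb = inj₂ (within⇒near ρa≤ρb (within-mono (≤-reflexive (m≤n⇒m⊔n≡n ρa≤ρb)) w))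
... | w | inj₂ ρb≤ρa = inj₁ (within⇒near ρb≤ρa (within-sym (within-mono (≤-reflexive (m≥n⇒m⊔n≡m ρb≤ρa)) w)))

-- Blocks

𝟙 : ∀ {p} {P : Set p} → Dec P → ℕ
𝟙 (yes _) = 1
𝟙 (no _)  = 0

𝟙≤1 : ∀ {p} {P : Set p} (p? : Dec P) → 𝟙 p? ≤ 1
𝟙≤1 (yes _) = ≤-refl
𝟙≤1 (no _)  = z≤n

1≤𝟙 : ∀ {p} {P : Set p} (p? : Dec P) → P → 1 ≤ 𝟙 p?
1≤𝟙 (yes _) _ = ≤-refl
1≤𝟙 (no ¬p) p = contradiction p ¬p

𝟙-mono : ∀ {p q} {P : Set p} {Q : Set q} → (P → Q) → (p? : Dec P) (q? : Dec Q) → 𝟙 p? ≤ 𝟙 q?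
𝟙-mono _   (yes _) (yes _) = ≤-refl
𝟙-mono P⇒Q (yes p) (no ¬q) = contradiction (P⇒Q p) ¬q
𝟙-mono _   (no _)  _       = z≤n

𝟙-cover : ∀ {p q r} {P : Set p} {Q : Set q} {R : Set r} → (R → P ⊎ Q) →
          (r? : Dec R) (p? : Dec P) (q? : Dec Q) → 𝟙 r? + 𝟙 (p? ×-dec q?) ≤ 𝟙 p? + 𝟙 q?
𝟙-cover _     r?      (yes _) (yes _) = +-monoˡ-≤ 1 (𝟙≤1 r?)
𝟙-cover _     r?      (yes _) (no _)  = ≤-trans (≤-reflexive (+-identityʳ (𝟙 r?))) (𝟙≤1 r?)
𝟙-cover _     r?      (no _)  (yes _) = ≤-trans (≤-reflexive (+-identityʳ (𝟙 r?))) (𝟙≤1 r?)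
𝟙-cover R⇒P⊎Q (yes r) (no ¬p) (no ¬q) = contradiction (R⇒P⊎Q r) [ ¬p , ¬q ]
𝟙-cover _     (no _)  (no _)  (no _)  = z≤n

𝟙good : ℕ → ℕ → ℕ
𝟙good a b = 𝟙 (good? (a , b))

𝟙diagonal : ℕ → ℕ → ℕ
𝟙diagonal a b = 𝟙 (a ≟ b)

𝟙mutual : ℕ → ℕ → ℕ
𝟙mutual a b = 𝟙 (near? a b ×-dec near? b a)

Block : (ℕ → ℕ → ℕ) → ℕ → ℕ → ℕ
Block H a b =
  (H (2 * a) (2 * b) + (H (2 * a) (1 + 2 * b) + H (1 + 2 * a) (2 * b))) + H (1 + 2 * a) (1 + 2 * b)

good-block : ∀ a b → .{{NonZero a}} → .{{NonZero b}} →
             (𝟙good a b + (𝟙good a b + 𝟙mutual a b)) + 𝟙diagonal a b ≤ Block 𝟙good a b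
good-block a b = +-mono-≤ (+-mono-≤ doubled crossed) odd-diagonal
  where
  doubled : 𝟙good a b ≤ 𝟙good (2 * a) (2 * b)
  doubled = 𝟙-mono good-double (good? (a , b)) (good? (2 * a , 2 * b))
  crossed : 𝟙good a b + 𝟙mutual a b ≤ 𝟙good (2 * a) (1 + 2 * b) + 𝟙good (1 + 2 * a) (2 * b)
  crossed = ≤-trans (𝟙-cover good⇒near⊎near (good? (a , b)) (near? a b) (near? b a))
                    (+-mono-≤ (𝟙-mono near⇒good (near? a b) (good? (2 * a , 1 + 2 * b)))
                              (𝟙-mono (good-sym (2 * b) (1 + 2 * a) ∘ near⇒good) (near? b a) (good? (1 + 2 * a , 2 * b))))
  odd-diagonal : 𝟙diagonal a b ≤ 𝟙good (1 + 2 * a) (1 + 2 * b)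
  odd-diagonal = 𝟙-mono (λ { refl → good-refl (1 + 2 * a) }) (a ≟ b) (good? (1 + 2 * a , 1 + 2 * b))

mutual-block : ∀ a b → .{{NonZero a}} → .{{NonZero b}} →
               (𝟙mutual a b + (𝟙diagonal a b + 𝟙diagonal a b)) + 𝟙diagonal a b ≤ Block 𝟙mutual a b
mutual-block a b = +-mono-≤ (+-mono-≤ doubled (+-mono-≤ even-odd odd-even)) odd-odd
  where
  doubled : 𝟙mutual a b ≤ 𝟙mutual (2 * a) (2 * b)
  doubled = 𝟙-mono (λ (ab , ba) → near-double ab , near-double ba) _ _
  even-odd : 𝟙diagonal a b ≤ 𝟙mutual (2 * a) (1 + 2 * b)
  even-odd = 𝟙-mono (λ { refl → near-even-succ a , near-odd-pred a }) (a ≟ b) _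
  odd-even : 𝟙diagonal a b ≤ 𝟙mutual (1 + 2 * a) (2 * b)
  odd-even = 𝟙-mono (λ { refl → near-odd-pred a , near-even-succ a }) (a ≟ b) _
  odd-odd : 𝟙diagonal a b ≤ 𝟙mutual (1 + 2 * a) (1 + 2 * b)
  odd-odd = 𝟙-mono (λ { refl → near-refl (1 + 2 * a) , near-refl (1 + 2 * a) }) (a ≟ b) _

-- Sums over S

∑< : ℕ → (ℕ → ℕ) → ℕ
∑< n f = sum (applyUpTo f n)

∑<-cong : ∀ n {f g : ℕ → ℕ} → (∀ i → f i ≡ g i) → ∑< n f ≡ ∑< n g
∑<-cong zero    f≡g = refl
∑<-cong (suc n) f≡g = cong₂ _+_ (f≡g 0) (∑<-cong n (f≡g ∘ suc))

∑<-mono : ∀ n {f g : ℕ → ℕ} → (∀ i → i < n → f i ≤ g i) → ∑< n f ≤ ∑< n g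
∑<-mono zero    f≤g = z≤n
∑<-mono (suc n) f≤g = +-mono-≤ (f≤g 0 (s≤s z≤n)) (∑<-mono n (λ i i<n → f≤g (suc i) (s≤s i<n)))

∑<-distrib-+ : ∀ n (f g : ℕ → ℕ) → ∑< n (λ i → f i + g i) ≡ ∑< n f + ∑< n g
∑<-distrib-+ zero    f g = refl
∑<-distrib-+ (suc n) f g =
  trans (cong ((f 0 + g 0) +_) (∑<-distrib-+ n (f ∘ suc) (g ∘ suc))) (+-interchange (f 0) (g 0) _ _)

∑<-double : ∀ n f → ∑< (2 * n) f ≡ ∑< n (λ i → f (2 * i) + f (1 + 2 * i))
∑<-double zero    f = refl
∑<-double (suc n) f = begin
  ∑< (2 * suc n) f
    ≡⟨ cong (λ m → ∑< m f) (*-distribˡ-+ 2 1 n) ⟩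
  f 0 + (f 1 + ∑< (2 * n) (f ∘ suc ∘ suc))
    ≡⟨ +-assoc (f 0) (f 1) _ ⟨
  (f 0 + f 1) + ∑< (2 * n) (f ∘ suc ∘ suc)
    ≡⟨ cong ((f 0 + f 1) +_) (∑<-double n (f ∘ suc ∘ suc)) ⟩
  (f 0 + f 1) + ∑< n (λ i → f (2 + 2 * i) + f (3 + 2 * i))
    ≡⟨ cong ((f 0 + f 1) +_) (∑<-cong n λ i → cong (λ m → f m + f (1 + m)) (*-distribˡ-+ 2 1 i)) ⟨
  ∑< (suc n) (λ i → f (2 * i) + f (1 + 2 * i))
    ∎
  where open ≡-Reasoning

∑<-term : ∀ n f {i} → i < n → f i ≤ ∑< n f
∑<-term (suc n) f {zero}  _         = m≤m+n (f 0) _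
∑<-term (suc n) f {suc i} (s≤s i<n) = ≤-trans (∑<-term n (f ∘ suc) i<n) (m≤n+m _ (f 0))

∑<-ones : ∀ n → ∑< n (λ _ → 1) ≡ n
∑<-ones zero    = refl
∑<-ones (suc n) = cong suc (∑<-ones n)

∑² : ℕ → (ℕ → ℕ → ℕ) → ℕ
∑² n F = ∑< n (λ i → ∑< n (F i))

∑²-double : ∀ n F → ∑² (2 * n) F ≡ ∑² n (Block F)
∑²-double n F = begin
  ∑< (2 * n) (λ i → ∑< (2 * n) (F i))
    ≡⟨ ∑<-double n _ ⟩
  ∑< n (λ i → ∑< (2 * n) (F (2 * i)) + ∑< (2 * n) (F (1 + 2 * i)))
    ≡⟨ ∑<-cong n (λ i → cong₂ _+_ (∑<-double n (F (2 * i))) (∑<-double n (F (1 + 2 * i)))) ⟩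
  ∑< n (λ i → ∑< n (evenRow i) + ∑< n (oddRow i))
    ≡⟨ ∑<-cong n (λ i → ∑<-distrib-+ n (evenRow i) (oddRow i)) ⟨
  ∑< n (λ i → ∑< n (λ j → evenRow i j + oddRow i j))
    ≡⟨ ∑<-cong n (λ i → ∑<-cong n (λ j → regroup (F (2 * i) (2 * j)) _ _ _)) ⟩
  ∑² n (Block F)
    ∎
  where
  open ≡-Reasoning
  evenRow oddRow : ℕ → ℕ → ℕ
  evenRow i j = F (2 * i) (2 * j) + F (2 * i) (1 + 2 * j)
  oddRow  i j = F (1 + 2 * i) (2 * j) + F (1 + 2 * i) (1 + 2 * j)
  regroup : ∀ w x y z → (w + x) + (y + z) ≡ (w + (x + y)) + z
  regroup w x y z = trans (sym (+-assoc (w + x) y z)) (cong (_+ z) (+-assoc w x y))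

2*m+2*n≡2*[m+n] : ∀ m n → 2 * m + 2 * n ≡ 2 * (m + n)
2*m+2*n≡2*[m+n] m n = sym (*-distribˡ-+ 2 m n)

2*m+[1+2*n]≡1+2*[m+n] : ∀ m n → 2 * m + (1 + 2 * n) ≡ 1 + 2 * (m + n)
2*m+[1+2*n]≡1+2*[m+n] m n = trans (+-suc (2 * m) (2 * n)) (cong suc (2*m+2*n≡2*[m+n] m n))

shift : ℕ → (ℕ → ℕ → ℕ) → ℕ → ℕ → ℕ
shift lo H i j = H (lo + i) (lo + j)

Block-shift : ∀ lo H i j → Block (shift (2 * lo) H) i j ≡ Block H (lo + i) (lo + j)
Block-shift lo H i j
  rewrite 2*m+2*n≡2*[m+n] lo i | 2*m+2*n≡2*[m+n] lo j
        | 2*m+[1+2*n]≡1+2*[m+n] lo i | 2*m+[1+2*n]≡1+2*[m+n] lo j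
  = refl

-- ∑S k H is the sum of H over S (2 + k) = [3 · 2 ^ k, 4 · 2 ^ k)².
∑S : ℕ → (ℕ → ℕ → ℕ) → ℕ
∑S k H = ∑² (2 ^ k) (shift (3 * 2 ^ k) H)

∑S-suc : ∀ k H → ∑S (suc k) H ≡ ∑S k (Block H)
∑S-suc k H = begin
  ∑² (2 * p) (shift (3 * (2 * p)) H)
    ≡⟨ cong (λ lo → ∑² (2 * p) (shift lo H)) 3*[2*p]≡2*[3*p] ⟩
  ∑² (2 * p) (shift (2 * (3 * p)) H)
    ≡⟨ ∑²-double p _ ⟩
  ∑² p (Block (shift (2 * (3 * p)) H))
    ≡⟨ ∑<-cong p (λ i → ∑<-cong p (Block-shift (3 * p) H i)) ⟩
  ∑S k (Block H)
    ∎
  where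
  open ≡-Reasoning
  p : ℕ
  p = 2 ^ k
  3*[2*p]≡2*[3*p] : 3 * (2 * p) ≡ 2 * (3 * p)
  3*[2*p]≡2*[3*p] = trans (sym (*-assoc 3 2 p)) (*-assoc 2 3 p)

∑S-mono : ∀ k {F G : ℕ → ℕ → ℕ} → (∀ a b → .{{NonZero a}} → .{{NonZero b}} → F a b ≤ G a b) →
          ∑S k F ≤ ∑S k G
∑S-mono k F≤G = ∑<-mono (2 ^ k) λ i _ → ∑<-mono (2 ^ k) λ j _ →
  F≤G (lo + i) (lo + j) {{lo+-nonZero i}} {{lo+-nonZero j}}
  where
  lo : ℕ
  lo = 3 * 2 ^ k
  lo+-nonZero : ∀ i → NonZero (lo + i)
  lo+-nonZero i = >-nonZero (≤-trans (m^n>0 2 k) (≤-trans (m≤m+n (2 ^ k) _) (m≤m+n lo i)))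

∑S-distrib-+ : ∀ k (F G : ℕ → ℕ → ℕ) → ∑S k (λ a b → F a b + G a b) ≡ ∑S k F + ∑S k G
∑S-distrib-+ k F G = trans (∑<-cong (2 ^ k) λ i → ∑<-distrib-+ (2 ^ k) _ _) (∑<-distrib-+ (2 ^ k) _ _)

2^k≤∑S-diagonal : ∀ k → 2 ^ k ≤ ∑S k 𝟙diagonal
2^k≤∑S-diagonal k = begin
  2 ^ k                 ≡⟨ ∑<-ones (2 ^ k) ⟨
  ∑< (2 ^ k) (λ _ → 1)  ≤⟨ ∑<-mono (2 ^ k) diagonal-term ⟩
  ∑S k 𝟙diagonal        ∎
  where
  open ≤-Reasoning
  lo : ℕ
  lo = 3 * 2 ^ k
  diagonal-term : ∀ i → i < 2 ^ k → 1 ≤ ∑< (2 ^ k) (λ j → 𝟙diagonal (lo + i) (lo + j))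
  diagonal-term i i<2^k = ≤-trans (1≤𝟙 (lo + i ≟ lo + i) refl) (∑<-term (2 ^ k) _ i<2^k)

length-filter≡sum-𝟙 : ∀ {A : Set} {P : A → Set} (P? : ∀ x → Dec (P x)) xs →
                      length (filter P? xs) ≡ sum (map (𝟙 ∘ P?) xs)
length-filter≡sum-𝟙 P? []       = refl
length-filter≡sum-𝟙 P? (x ∷ xs) with P? x
... | yes _ = cong suc (length-filter≡sum-𝟙 P? xs)
... | no _  = length-filter≡sum-𝟙 P? xs

sum-map-cartesianProduct : ∀ {A B : Set} (f : A × B → ℕ) xs ys →
  sum (map f (cartesianProduct xs ys)) ≡ sum (map (λ x → sum (map (λ y → f (x , y)) ys)) xs)
sum-map-cartesianProduct f []       ys = refl
sum-map-cartesianProduct f (x ∷ xs) ys = begin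
  sum (map f (map (x ,_) ys ++ cartesianProduct xs ys))
    ≡⟨ cong sum (map-++ f (map (x ,_) ys) _) ⟩
  sum (map f (map (x ,_) ys) ++ map f (cartesianProduct xs ys))
    ≡⟨ sum-++ (map f (map (x ,_) ys)) _ ⟩
  sum (map f (map (x ,_) ys)) + sum (map f (cartesianProduct xs ys))
    ≡⟨ cong₂ _+_ (cong sum (sym (map-∘ ys))) (sum-map-cartesianProduct f xs ys) ⟩
  sum (map (λ y → f (x , y)) ys) + sum (map (λ x → sum (map (λ y → f (x , y)) ys)) xs)
    ∎
  where open ≡-Reasoning

map-applyUpTo : ∀ {A B : Set} (f : A → B) g n → map f (applyUpTo g n) ≡ applyUpTo (f ∘ g) n
map-applyUpTo f g zero    = refl
map-applyUpTo f g (suc n) = cong (f (g 0) ∷_) (map-applyUpTo f (g ∘ suc) n)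

range-S : ∀ k → range (2 ^ (2 + k) ∸ 2 ^ k) (2 ^ (2 + k)) ≡ applyUpTo (3 * 2 ^ k +_) (2 ^ k)
range-S k = begin
  map (4p ∸ p +_) (applyUpTo id (4p ∸ (4p ∸ p)))
    ≡⟨ cong₂ (λ lo n → map (lo +_) (applyUpTo id n)) 4p∸p≡3p 4p∸[4p∸p]≡p ⟩
  map (3 * p +_) (applyUpTo id p)
    ≡⟨ map-applyUpTo (3 * p +_) id p ⟩
  applyUpTo (3 * p +_) p
    ∎
  where
  open ≡-Reasoning
  p 4p : ℕ
  p = 2 ^ k
  4p = 2 * (2 * p)
  4m≡3m+m : ∀ m → 2 * (2 * m) ≡ 3 * m + m
  4m≡3m+m = solve-∀
  4p≡3p+p : 4p ≡ 3 * p + p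
  4p≡3p+p = 4m≡3m+m p
  4p∸p≡3p : 4p ∸ p ≡ 3 * p
  4p∸p≡3p = trans (cong (_∸ p) 4p≡3p+p) (m+n∸n≡m (3 * p) p)
  4p∸[4p∸p]≡p : 4p ∸ (4p ∸ p) ≡ p
  4p∸[4p∸p]≡p = trans (cong₂ _∸_ 4p≡3p+p 4p∸p≡3p) (m+n∸m≡n (3 * p) p)

x≡∑S : ∀ k → x (2 + k) ≡ ∑S k 𝟙good
x≡∑S k = begin
  length (filter good? (S (2 + k)))
    ≡⟨ cong (λ r → length (filter good? (cartesianProduct r r))) (range-S k) ⟩
  length (filter good? (cartesianProduct r r))
    ≡⟨ length-filter≡sum-𝟙 good? (cartesianProduct r r) ⟩
  sum (map (𝟙 ∘ good?) (cartesianProduct r r))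
    ≡⟨ sum-map-cartesianProduct (𝟙 ∘ good?) r r ⟩
  sum (map (λ a → sum (map (𝟙good a) r)) r)
    ≡⟨ cong sum (map-applyUpTo _ (lo +_) p) ⟩
  ∑< p (λ i → sum (map (𝟙good (lo + i)) r))
    ≡⟨ ∑<-cong p (λ i → cong sum (map-applyUpTo _ (lo +_) p)) ⟩
  ∑S k 𝟙good
    ∎
  where
  open ≡-Reasoning
  p lo : ℕ
  p = 2 ^ k
  lo = 3 * p
  r : List ℕ
  r = applyUpTo (lo +_) p

-- The recursion

∑S-block-bound : ∀ k (F₁ F₂ F₃ F₄ H : ℕ → ℕ → ℕ) →
  (∀ a b → .{{NonZero a}} → .{{NonZero b}} → (F₁ a b + (F₂ a b + F₃ a b)) + F₄ a b ≤ Block H a b) →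
  (∑S k F₁ + (∑S k F₂ + ∑S k F₃)) + ∑S k F₄ ≤ ∑S (suc k) H
∑S-block-bound k F₁ F₂ F₃ F₄ H bound = begin
  (∑S k F₁ + (∑S k F₂ + ∑S k F₃)) + ∑S k F₄
    ≡⟨ cong (λ s → (∑S k F₁ + s) + ∑S k F₄) (∑S-distrib-+ k F₂ F₃) ⟨
  (∑S k F₁ + ∑S k F₂₃) + ∑S k F₄
    ≡⟨ cong (_+ ∑S k F₄) (∑S-distrib-+ k F₁ F₂₃) ⟨
  ∑S k F₁₂₃ + ∑S k F₄
    ≡⟨ ∑S-distrib-+ k F₁₂₃ F₄ ⟨
  ∑S k (λ a b → F₁₂₃ a b + F₄ a b)
    ≤⟨ ∑S-mono k bound ⟩
  ∑S k (Block H)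
    ≡⟨ ∑S-suc k H ⟨
  ∑S (suc k) H
    ∎
  where
  open ≤-Reasoning
  F₂₃ F₁₂₃ : ℕ → ℕ → ℕ
  F₂₃ a b = F₂ a b + F₃ a b
  F₁₂₃ a b = F₁ a b + F₂₃ a b

3*2^k≤∑S-mutual+2 : ∀ k → 3 * 2 ^ k ≤ ∑S k 𝟙mutual + 2
3*2^k≤∑S-mutual+2 zero    = ≤-refl    -- S 2 = {(3, 3)}, and 3 is near itself
3*2^k≤∑S-mutual+2 (suc k) = begin
  3 * (2 * p)
    ≡⟨ 6m≡3m+[[m+m]+m] p ⟩
  3 * p + ((p + p) + p)
    ≤⟨ +-mono-≤ (3*2^k≤∑S-mutual+2 k) (+-mono-≤ (+-mono-≤ p≤Δ p≤Δ) p≤Δ) ⟩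
  (M + 2) + ((Δ + Δ) + Δ)
    ≡⟨ regroup M Δ ⟩
  ((M + (Δ + Δ)) + Δ) + 2
    ≤⟨ +-monoˡ-≤ 2 (∑S-block-bound k 𝟙mutual 𝟙diagonal 𝟙diagonal 𝟙diagonal 𝟙mutual mutual-block) ⟩
  ∑S (suc k) 𝟙mutual + 2
    ∎
  where
  open ≤-Reasoning
  p M Δ : ℕ
  p = 2 ^ k
  M = ∑S k 𝟙mutual
  Δ = ∑S k 𝟙diagonal
  p≤Δ : p ≤ Δ
  p≤Δ = 2^k≤∑S-diagonal k
  6m≡3m+[[m+m]+m] : ∀ m → 3 * (2 * m) ≡ 3 * m + ((m + m) + m)
  6m≡3m+[[m+m]+m] = solve-∀
  regroup : ∀ m d → (m + 2) + ((d + d) + d) ≡ ((m + (d + d)) + d) + 2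
  regroup = solve-∀

mainTheorem9 : (n : ℕ) → 3 ≤ n → (2 * x (n ∸ 1) + 2 ^ (n ∸ 1)) ∸ 2 ≤ x n
mainTheorem9 (suc zero)       (s≤s ())
mainTheorem9 (suc (suc zero)) (s≤s (s≤s ()))
mainTheorem9 (suc (suc (suc k))) _ = m≤n+o⇒m∸n≤o _ 2 (begin
  2 * x (2 + k) + 2 * (2 * p)
    ≡⟨ cong (λ y → 2 * y + 2 * (2 * p)) (x≡∑S k) ⟩
  2 * X + 2 * (2 * p)
    ≡⟨ regroup₁ X p ⟩
  (X + (X + 3 * p)) + p
    ≤⟨ +-mono-≤ (+-monoʳ-≤ X (+-monoʳ-≤ X (3*2^k≤∑S-mutual+2 k))) (2^k≤∑S-diagonal k) ⟩
  (X + (X + (M + 2))) + Δ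
    ≡⟨ regroup₂ X M Δ ⟩
  2 + ((X + (X + M)) + Δ)
    ≤⟨ +-monoʳ-≤ 2 (∑S-block-bound k 𝟙good 𝟙good 𝟙mutual 𝟙diagonal 𝟙good good-block) ⟩
  2 + ∑S (suc k) 𝟙good
    ≡⟨ cong (2 +_) (x≡∑S (suc k)) ⟨
  2 + x (3 + k)
    ∎)
  where
  open ≤-Reasoning
  p X M Δ : ℕ
  p = 2 ^ k
  X = ∑S k 𝟙good
  M = ∑S k 𝟙mutual
  Δ = ∑S k 𝟙diagonal
  regroup₁ : ∀ y q → 2 * y + 2 * (2 * q) ≡ (y + (y + 3 * q)) + q
  regroup₁ = solve-∀
  regroup₂ : ∀ y m d → (y + (y + (m + 2))) + d ≡ 2 + ((y + (y + m)) + d)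
  regroup₂ = solve-∀
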